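{- Let $m>0$. Let $2\le a\le b\le c$ and $2\le a'\le b'\le c'$ be integers with $c'=c-1$ such that $(F(a),F(b),F(c))$ and $(F(a'),F(b'),F(c'))$ are both minimal Markoff $m$-triples (for the same $m$). If $c\ge 7$, then $a+b=c-1$.
   Context: $F(n)$ denotes the $n$-th Fibonacci number, $F(0)=0$, $F(1)=1$, $F(n+1)=F(n)+F(n-1)$. A Markoff $m$-triple is a triple $(x,y,z)$ of positive integers with $x\le y\le z$ satisfying $x^2+y^2+z^2=3xyz+m$; it is minimal if $z\ge 3xy$. -}

module Defs where

open import Data.Nat using (ℕ; zero; suc; _+_; _*_; _≤_)
open import Data.Product using (_×_)
open import Relation.Binary.PropositionalEquality using (_≡_)

F : ℕ → ℕ
F zero = 0
F (suc zero) = 1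
F (suc (suc n)) = F (suc n) + F n

MarkoffTriple : ℕ → ℕ → ℕ → ℕ → Set
MarkoffTriple m x y z =
  (1 ≤ x) × (x ≤ y) × (y ≤ z) × (x * x + y * y + z * z ≡ 3 * x * y * z + m)

MinimalMarkoffTriple : ℕ → ℕ → ℕ → ℕ → Set
MinimalMarkoffTriple m x y z = MarkoffTriple m x y z × (3 * x * y ≤ z)

-- If c ≤ a + b, then F c ≤ F (a + b) < 3 F(a) F(b), contradicting minimality.
-- If a + b + 1 < c, then F (c - 1) ≥ F (a + b + 1) ≥ 3 F(a) F(b), so writing
-- F c = F (c - 1) + F (c - 2) the Markoff equation gives
-- m ≥ F(a)² + F(b)² + F(c) F(c - 2) > F(c - 1)² by Cassini's identity;
-- but every Markoff m-triple with largest entry z has m < z².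
module Submission where

open import Defs
open import Data.Nat using (ℕ; zero; suc; _+_; _*_; _≤_; _≰_; _<_; _≤′_; ≤′-refl; ≤′-step; z≤n; s≤s; >-nonZero; s≤s⁻¹; _≤?_)
open import Data.Nat.Properties
open import Data.Nat.Solver using (module +-*-Solver)
open import Data.Product using (_,_; proj₁; proj₂)
open import Data.Sum using (_⊎_; inj₁; inj₂)
open import Relation.Nullary using (yes; no; contradiction)
open import Relation.Binary using (tri<; tri≈; tri>)
open import Relation.Binary.PropositionalEquality using (_≡_; refl; sym; trans; cong)

open +-*-Solver
open ≤-Reasoning

F-step : ∀ n → F n ≤ F (suc n)
F-step zero    = z≤n
F-step (suc n) = m≤m+n (F (suc n)) (F n)

F-mono-≤′ : ∀ {m n} → m ≤′ n → F m ≤ F n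
F-mono-≤′ ≤′-refl            = ≤-refl
F-mono-≤′ (≤′-step {n} m≤′n) = ≤-trans (F-mono-≤′ m≤′n) (F-step n)

F-mono-≤ : ∀ {m n} → m ≤ n → F m ≤ F n
F-mono-≤ m≤n = F-mono-≤′ (≤⇒≤′ m≤n)

F-pos : ∀ n → 1 ≤ F (suc n)
F-pos zero    = ≤-refl
F-pos (suc n) = ≤-trans (F-pos n) (F-step (suc n))

F-add : ∀ m n → F (suc (m + n)) ≡ F (suc m) * F (suc n) + F m * F n
F-add zero    n = solve 1 (λ x → x := con 1 :* x :+ con 0) refl (F (suc n))
F-add (suc m) n = begin-equality
  F (suc (suc m + n))                                 ≡⟨ cong (λ k → F (suc k)) (sym (+-suc m n)) ⟩
  F (suc (m + suc n))                                 ≡⟨ F-add m (suc n) ⟩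
  F (suc m) * F (suc (suc n)) + F m * F (suc n)       ≡⟨ solve 4 (λ p q r s → p :* (r :+ s) :+ q :* r
                                                                          := (p :+ q) :* r :+ p :* s)
                                                                refl (F (suc m)) (F m) (F (suc n)) (F n) ⟩
  F (suc (suc m)) * F (suc n) + F (suc m) * F n       ∎

-- The defect F (n+2) F n - F (n+1)² changes sign from n to n + 1.
cassini-step : ∀ n → F (3 + n) * F (suc n) + F (2 + n) * F n
                   ≡ F (2 + n) * F (2 + n) + F (suc n) * F (suc n)
cassini-step n = solve 2 (λ a b → (a :+ b :+ a) :* a :+ (a :+ b) :* b
                                := (a :+ b) :* (a :+ b) :+ a :* a) refl (F (suc n)) (F n)

shift-by-one : ∀ {c d x y} → c + x ≡ d + y → x + 1 ≡ y → c ≡ d + 1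
shift-by-one {c} {d} {x} c+x≡d+y refl = +-cancelʳ-≡ x c (d + 1) (begin-equality
  c + x         ≡⟨ c+x≡d+y ⟩
  d + (x + 1)   ≡⟨ solve 2 (λ d x → d :+ (x :+ con 1) := d :+ con 1 :+ x) refl d x ⟩
  d + 1 + x     ∎)

cassini : ∀ n → F (2 + n) * F n + 1 ≡ F (suc n) * F (suc n)
              ⊎ F (2 + n) * F n ≡ F (suc n) * F (suc n) + 1
cassini zero = inj₁ refl
cassini (suc n) with cassini n
... | inj₁ eq = inj₂ (shift-by-one (cassini-step n) eq)
... | inj₂ eq = inj₁ (sym (shift-by-one (sym (cassini-step n)) (sym eq)))

cassini-≤ : ∀ n → F (suc n) * F (suc n) ≤ F (2 + n) * F n + 1
cassini-≤ n with cassini n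
... | inj₁ eq = ≤-reflexive (sym eq)
... | inj₂ eq = begin
  F (suc n) * F (suc n)           ≤⟨ m≤m+n _ 2 ⟩
  F (suc n) * F (suc n) + 2       ≡⟨ +-assoc _ 1 1 ⟨
  F (suc n) * F (suc n) + 1 + 1   ≡⟨ cong (_+ 1) eq ⟨
  F (2 + n) * F n + 1             ∎

2*[p+q]*[r+s]≤[p+q+p]*[r+s+r] : ∀ {p q r s} → q ≤ p → s ≤ r →
                  2 * ((p + q) * (r + s)) ≤ (p + q + p) * (r + s + r)
2*[p+q]*[r+s]≤[p+q+p]*[r+s+r] {p} {q} {r} {s} q≤p s≤r = +-cancelʳ-≤ (p * r) _ _ (begin
  2 * ((p + q) * (r + s)) + p * r   ≤⟨ +-monoʳ-≤ (2 * ((p + q) * (r + s))) (m≤m+n (p * r) (q * s)) ⟩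
  2 * ((p + q) * (r + s)) + (p * r + q * s)
    ≤⟨ +-monoʳ-≤ (2 * ((p + q) * (r + s))) (+-monoʳ-≤ (p * r) (*-mono-≤ q≤p s≤r)) ⟩
  2 * ((p + q) * (r + s)) + (p * r + p * r)
    ≡⟨ solve 4 (λ p q r s → con 2 :* ((p :+ q) :* (r :+ s)) :+ (p :* r :+ p :* r)
                          := (p :+ q :+ p) :* (r :+ s :+ r) :+ q :* s) refl p q r s ⟩
  (p + q + p) * (r + s + r) + q * s ≤⟨ +-monoʳ-≤ ((p + q + p) * (r + s + r)) (*-mono-≤ q≤p s≤r) ⟩
  (p + q + p) * (r + s + r) + p * r ∎)

p*[r+s]+q*r<3*p*r : ∀ {p q r s} → 1 ≤ p → q ≤ p → s < r → p * (r + s) + q * r < 3 * p * r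
p*[r+s]+q*r<3*p*r {p} {q} {r} {s} 1≤p q≤p s<r = begin-strict
  p * (r + s) + q * r   <⟨ +-mono-<-≤ (*-monoʳ-< p {{>-nonZero 1≤p}} (+-monoʳ-< r s<r)) (*-monoˡ-≤ r q≤p) ⟩
  p * (r + r) + p * r   ≡⟨ solve 2 (λ p r → p :* (r :+ r) :+ p :* r := con 3 :* p :* r) refl p r ⟩
  3 * p * r             ∎

3*F[a]*F[b]≤F[1+a+b] : ∀ {a b} → 2 ≤ a → 2 ≤ b → 3 * F a * F b ≤ F (suc (a + b))
3*F[a]*F[b]≤F[1+a+b] {a@(suc (suc a₀))} {b@(suc (suc b₀))} (s≤s (s≤s _)) (s≤s (s≤s _)) = begin
  3 * F a * F b                         ≡⟨ solve 2 (λ x y → con 3 :* x :* y := con 2 :* (x :* y) :+ x :* y) refl (F a) (F b) ⟩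
  2 * (F a * F b) + F a * F b           ≤⟨ +-monoˡ-≤ (F a * F b) (2*[p+q]*[r+s]≤[p+q+p]*[r+s+r] (F-step a₀) (F-step b₀)) ⟩
  F (suc a) * F (suc b) + F a * F b     ≡⟨ F-add a b ⟨
  F (suc (a + b))                       ∎

F[a+b]<3*F[a]*F[b] : ∀ {a b} → 1 ≤ a → 3 ≤ b → F (a + b) < 3 * F a * F b
F[a+b]<3*F[a]*F[b] {a@(suc a₁)} {b@(suc (suc (suc b₀)))} (s≤s _) (s≤s (s≤s (s≤s _))) = begin-strict
  F (a + b)                             ≡⟨ F-add a₁ b ⟩
  F a * F (suc b) + F a₁ * F b          <⟨ p*[r+s]+q*r<3*p*r {F a} {F a₁} {F b} (F-pos a₁) (F-step a₁) (m<m+n _ (F-pos b₀)) ⟩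
  3 * F a * F b                         ∎

markoff-m<z² : ∀ {m x y z} → MarkoffTriple m x y z → m < z * z
markoff-m<z² {m} {x} {y} {z} (1≤x , x≤y , y≤z , markoff) =
  +-cancelˡ-< (3 * x * y * z) m (z * z) (begin-strict
    3 * x * y * z + m           ≡⟨ markoff ⟨
    x * x + y * y + z * z       <⟨ +-monoˡ-< (z * z) x²+y²<3xyz ⟩
    3 * x * y * z + z * z       ∎)
  where
  x≤z = ≤-trans x≤y y≤z
  x²+y²<3xyz : x * x + y * y < 3 * x * y * z
  x²+y²<3xyz = begin-strict
    x * x + y * y               ≤⟨ +-mono-≤ (*-mono-≤ x≤y x≤z) (*-monoʳ-≤ y y≤z) ⟩
    y * z + y * z               <⟨ m<m+n (y * z + y * z) (*-mono-≤ (≤-trans 1≤x x≤y) (≤-trans 1≤x x≤z)) ⟩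
    y * z + y * z + y * z       ≡⟨ solve 2 (λ y z → y :* z :+ y :* z :+ y :* z := con 3 :* con 1 :* y :* z) refl y z ⟩
    3 * 1 * y * z               ≤⟨ *-monoˡ-≤ z (*-monoˡ-≤ y (*-monoʳ-≤ 3 1≤x)) ⟩
    3 * x * y * z               ∎

markoff-x²+y²+zd≤m : ∀ {m x y z d} → x * x + y * y + z * z ≡ 3 * x * y * z + m →
                     3 * x * y + d ≤ z → x * x + y * y + z * d ≤ m
markoff-x²+y²+zd≤m {m} {x} {y} {z} {d} markoff 3xy+d≤z =
  +-cancelˡ-≤ (3 * x * y * z) (x * x + y * y + z * d) m (begin
    3 * x * y * z + (x * x + y * y + z * d)
      ≡⟨ solve 4 (λ x y z d → con 3 :* x :* y :* z :+ (x :* x :+ y :* y :+ z :* d)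
                            := x :* x :+ y :* y :+ z :* (con 3 :* x :* y :+ d)) refl x y z d ⟩
    x * x + y * y + z * (3 * x * y + d)   ≤⟨ +-monoʳ-≤ (x * x + y * y) (*-monoʳ-≤ z 3xy+d≤z) ⟩
    x * x + y * y + z * z                 ≡⟨ markoff ⟩
    3 * x * y * z + m                     ∎)

-- Minimality with z = F (n + 2) = F (n + 1) + F n leaves the excess F (n + 2) F n, and Cassini compares it with F (n + 1)².
F[1+n]²<m : ∀ {m x y n} → MarkoffTriple m x y (F (2 + n)) → 3 * x * y ≤ F (suc n) →
            F (suc n) * F (suc n) < m
F[1+n]²<m {m} {x} {y} {n} (1≤x , x≤y , _ , markoff) 3xy≤F[1+n] = begin-strict
  F (suc n) * F (suc n)                 ≤⟨ cassini-≤ n ⟩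
  F (2 + n) * F n + 1                   <⟨ +-monoʳ-< (F (2 + n) * F n) (+-mono-≤ (*-mono-≤ 1≤x 1≤x) (*-mono-≤ 1≤y 1≤y)) ⟩
  F (2 + n) * F n + (x * x + y * y)     ≡⟨ +-comm (F (2 + n) * F n) (x * x + y * y) ⟩
  x * x + y * y + F (2 + n) * F n       ≤⟨ markoff-x²+y²+zd≤m {m} {x} {y} {F (2 + n)} {F n} markoff (+-monoˡ-≤ (F n) 3xy≤F[1+n]) ⟩
  m                                     ∎
  where
  1≤y = ≤-trans 1≤x x≤y

3≤larger : ∀ {a b} → a ≤ b → 5 ≤ a + b → 3 ≤ b
3≤larger {a} {b} a≤b 5≤a+b with 3 ≤? b
... | yes 3≤b = 3≤b
... | no 3≰b  = contradiction 5≤a+b (<⇒≱ (s≤s (+-mono-≤ (≤-trans a≤b b≤2) b≤2)))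
  where
  b≤2 = s≤s⁻¹ (≰⇒> 3≰b)

F[c]<3*F[a]*F[b] : ∀ {a b c} → 1 ≤ a → a ≤ b → 5 ≤ c → c ≤ a + b → F c < 3 * F a * F b
F[c]<3*F[a]*F[b] 1≤a a≤b 5≤c c≤a+b =
  ≤-<-trans (F-mono-≤ c≤a+b) (F[a+b]<3*F[a]*F[b] 1≤a (3≤larger a≤b (≤-trans 5≤c c≤a+b)))

1+a+b≰c : ∀ {m a b a' b' c} → 2 ≤ a → 2 ≤ b →
          MinimalMarkoffTriple m (F a) (F b) (F (suc c)) →
          MarkoffTriple m (F a') (F b') (F c) → suc (a + b) ≰ c
1+a+b≰c {a = a} {b} {c = suc n} 2≤a 2≤b (markoff , _) markoff' 1+a+b≤c =
  <-asym (markoff-m<z² markoff')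
         (F[1+n]²<m {n = n} markoff (≤-trans (3*F[a]*F[b]≤F[1+a+b] 2≤a 2≤b) (F-mono-≤ 1+a+b≤c)))

lemma4p12 : (m a b c a' b' c' : ℕ) → 0 < m →
    2 ≤ a → a ≤ b → b ≤ c → 2 ≤ a' → a' ≤ b' → b' ≤ c' →
    c' + 1 ≡ c →
    MinimalMarkoffTriple m (F a) (F b) (F c) →
    MinimalMarkoffTriple m (F a') (F b') (F c') →
    7 ≤ c →
    a + b + 1 ≡ c
lemma4p12 m a b c a' b' c' _ 2≤a a≤b _ _ _ _ c'+1≡c minimal minimal' 7≤c
  with trans (sym c'+1≡c) (+-comm c' 1)
... | refl with <-cmp (suc (a + b)) c
...   | tri≈ _ 1+a+b≡c _ = trans (+-comm (a + b) 1) 1+a+b≡c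
...   | tri< 1+a+b<c _ _ =
  contradiction (s≤s⁻¹ 1+a+b<c) (1+a+b≰c {a' = a'} {b'} 2≤a (≤-trans 2≤a a≤b) minimal (proj₁ minimal'))
...   | tri> _ _ c<1+a+b =
  contradiction (proj₂ minimal) (<⇒≱ (F[c]<3*F[a]*F[b] (≤-trans (s≤s z≤n) 2≤a) a≤b (≤-trans (m≤n+m 5 2) 7≤c) (s≤s⁻¹ c<1+a+b)))
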